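{- For every integer $n\ge 2$, during a complete run of $\mathrm{AccelDesc}(n)$, the read operations are the test "$d_q=2$" and the statement "$m\leftarrow d_q-1$". Together they are executed a total of exactly $2p(n)-p(n-2)-2$ times.
   Context: $p(n)$ denotes the number of partitions of $n$, with $p(0)=1$. The procedure $\mathrm{AccelDesc}(n)$ (Zoghbi and Stojmenović's algorithm) operates on an array $d$ as follows and visits every descending composition of $n$ (a sequence of positive integers in nonincreasing order summing to $n$) exactly once: 1. $k\leftarrow1$; $q\leftarrow1$; $d_2,\dots,d_n\leftarrow 1$; $d_1\leftarrow n$; visit $\langle d_1\rangle$. 2. While $q\ne 0$: - If $d_q=2$: $k\leftarrow k+1$; $d_q\leftarrow 1$; $q\leftarrow q-1$. - Else: - $m\leftarrow d_q-1$; $n'\leftarrow k-q+1$; $d_q\leftarrow m$. - While $n'\ge m$: $q\leftarrow q+1$; $d_q\leftarrow m$; $n'\leftarrow n'-m$. - If $n'=0$: $k\leftarrow q$. - Else: $k\leftarrow q+1$; if $n'>1$ then $q\leftarrow q+1$ and $d_q\leftarrow n'$. - Visit $\langle d_1,\dots,d_k\rangle$. -}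

module Defs where

open import Data.Nat using (ℕ; zero; suc; _+_; _*_; _∸_; _≤_; _≥_; _≤?_; _≟_)
open import Data.Nat.Properties using ()
open import Data.Bool using (Bool; true; false; if_then_else_)
open import Data.List using (List; []; _∷_; [_]; map; concatMap; upTo; length; filter)
open import Data.Nat.ListAction using (sum)
open import Data.List.Relation.Unary.All using (All)
import Data.List.Relation.Unary.All as All
open import Data.List.Relation.Unary.Linked using (Linked)
import Data.List.Relation.Unary.Linked as Linked
open import Data.Maybe using (Maybe; just; nothing)
open import Data.Product using (_×_)
open import Relation.Binary.PropositionalEquality using (_≡_)
open import Relation.Nullary using (Dec; yes; no; does)
open import Relation.Nullary.Decidable using (_×-dec_)

IsPartition : ℕ → List ℕ → Set
IsPartition n xs = All (1 ≤_) xs × Linked (λ a b → b ≤ a) xs × sum xs ≡ n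

isPartition? : (n : ℕ) (xs : List ℕ) → Dec (IsPartition n xs)
isPartition? n xs =
  All.all? (1 ≤?_) xs ×-dec (Linked.linked? (λ a b → b ≤? a) xs ×-dec (sum xs ≟ n))

listsOf : ℕ → ℕ → List (List ℕ)
listsOf zero    n = [ [] ]
listsOf (suc L) n = concatMap (λ x → map (x ∷_) (listsOf L n)) (map suc (upTo n))

-- all lists of length ≤ n with entries in {1,…,n} (each exactly once);
-- every partition of n occurs among them
candidates : ℕ → List (List ℕ)
candidates n = concatMap (λ L → listsOf L n) (upTo (suc n))

p : ℕ → ℕ
p n = length (filter (isPartition? n) (candidates n))

-- AccelDesc(n) as a small-step machine.  Only reads of the array d
-- are counted: the test "d_q = 2" and the statement "m ← d_q − 1".

data PC : Set where
  outer inner : PC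

record State : Set where
  constructor mkState
  field
    d     : ℕ → ℕ   -- the array (index 1..n used)
    k     : ℕ
    q     : ℕ
    m     : ℕ
    n'    : ℕ
    reads : ℕ
    pc    : PC

open State public

upd : (ℕ → ℕ) → ℕ → ℕ → (ℕ → ℕ)
upd d i v j = if does (j ≟ i) then v else d j

data Step : Set where
  halt : ℕ → Step
  next : State → Step

step : State → Step
-- outer loop head: "while q ≠ 0"
step (mkState d k zero m n' r outer) = halt r
step (mkState d k q@(suc _) m n' r outer) =
  if does (d q ≟ 2)
    -- read #1 (the test) ; then k ← k+1, d_q ← 1, q ← q−1
    then next (mkState (upd d q 1) (suc k) (q ∸ 1) m n' (suc r) outer)
    -- read #1 (the test) and read #2 (m ← d_q − 1);
    -- n' ← k − q + 1 ; d_q ← m ; go to inner loop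
    else next (mkState (upd d q (d q ∸ 1)) k q (d q ∸ 1) (suc k ∸ q) (suc (suc r)) inner)
-- inner loop: "while n' ≥ m"
step (mkState d k q m n' r inner) =
  if does (m ≤? n')
    then next (mkState (upd d (suc q) m) k (suc q) m (n' ∸ m) r inner)
    else (if does (n' ≟ 0)
      then next (mkState d q q m n' r outer)
      else (if does (2 ≤? n')
        then next (mkState (upd d (suc q) n') (suc q) (suc q) m n' r outer)
        else next (mkState d (suc q) q m n' r outer)))

run : ℕ → State → Maybe ℕ
run zero    s = nothing
run (suc f) s with step s
... | halt r  = just r
... | next s' = run f s'

initArray : ℕ → ℕ → ℕ
initArray n zero          = 0
initArray n (suc zero)    = n
initArray n i@(suc (suc _)) = if does (i ≤? n) then 1 else 0

initState : ℕ → State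
initState n = mkState (initArray n) 1 1 0 0 0 outer

module Submission where

-- Every iteration of the outer loop turns the current partition into the next
-- one; it reads once if the smallest part d_q > 1 equals 2 and twice otherwise.
-- So the reads number (p(n) − 1) + (p(n) − 1 − p(n − 2)), since the partitions
-- containing a 2 correspond to the partitions of n − 2.  To make this an
-- induction we generalise to blocks of the run: started on the greedy
-- (lexicographically largest) partition of s into parts ≤ a above a fixed
-- stack of larger parts, the machine passes through all count s a such
-- partitions, ends with s ones above that stack, and reads
-- 2·count s a − withTwo s a − 2 times (simulate, by induction on s + a).

open import Defs
open import Data.Nat using (ℕ; zero; suc; _+_; _*_; _∸_; _≤_; _<_; z≤n; s≤s; _≤?_; _<?_; _≟_)
open import Data.Nat.Properties
open import Data.Nat.Induction using (<-wellFounded)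
open import Data.Nat.ListAction using (sum)
open import Data.Nat.Tactic.RingSolver using (solve-∀)
open import Induction.WellFounded using (Acc; acc)
open import Data.List using (List; []; _∷_; map; concatMap; upTo; length; _++_)
open import Data.List.Properties using (∷-injectiveˡ; ∷-injectiveʳ; length-map; length-++)
open import Data.List.Relation.Unary.All using (All; []; _∷_)
import Data.List.Relation.Unary.All as All
open import Data.List.Relation.Unary.Any using (here)
open import Data.List.Relation.Unary.Linked using (Linked; [-]; _∷_)
import Data.List.Relation.Unary.Linked as Linked
open import Data.List.Relation.Unary.Linked.Properties using (Linked⇒All)
open import Data.List.Relation.Unary.Unique.Propositional using (Unique; []; _∷_)
import Data.List.Relation.Unary.Unique.Propositional.Properties as Unique
open import Data.List.Membership.Propositional using (_∈_; find; lose)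
open import Data.List.Membership.Propositional.Properties
  using (∈-++⁻; ∈-++⁺ˡ; ∈-++⁺ʳ; ∈-map⁻; ∈-map⁺; ∈-concatMap⁻; ∈-concatMap⁺; ∈-upTo⁺;
         ∈-filter⁻; ∈-filter⁺)
open import Data.List.Membership.Propositional.Properties.WithK using (unique∧set⇒bag)
open import Data.List.Relation.Binary.BagAndSetEquality using (∼bag⇒↭)
open import Data.List.Relation.Binary.Permutation.Propositional.Properties using (↭-length)
open import Data.Maybe using (just)
open import Data.Product using (Σ; _×_; _,_; proj₁; proj₂)
open import Data.Sum using (inj₁; inj₂)
open import Data.Empty using (⊥-elim)
open import Data.Unit using (⊤; tt)
open import Function.Bundles using (mk⇔)
open import Relation.Binary.PropositionalEquality
open import Relation.Nullary using (Dec; yes; no; ¬_)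
open import Relation.Nullary.Decidable using (dec-true; dec-false)

sameLength : {A : Set} {xs ys : List A} → Unique xs → Unique ys →
  (∀ {z} → z ∈ xs → z ∈ ys) → (∀ {z} → z ∈ ys → z ∈ xs) → length xs ≡ length ys
sameLength uxs uys to from = ↭-length (∼bag⇒↭ (unique∧set⇒bag uxs uys (mk⇔ to from)))

Descending : List ℕ → Set
Descending = Linked (λ a b → b ≤ a)

Bounded : ℕ → ℕ → List ℕ → Set
Bounded s a x = IsPartition s x × All (_≤ a) x

entry≤sum : ∀ xs → All (_≤ sum xs) xs
entry≤sum [] = []
entry≤sum (x ∷ xs) =
  m≤m+n x (sum xs) ∷ All.map (λ le → ≤-trans le (m≤n+m (sum xs) x)) (entry≤sum xs)

head-bounds : ∀ {h t} → Descending (h ∷ t) → All (_≤ h) (h ∷ t)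
head-bounds = Linked⇒All (λ j≤i k≤j → ≤-trans k≤j j≤i) ≤-refl

partition-bounded : ∀ {s b x} → IsPartition s x → s ≤ b → Bounded s b x
partition-bounded {x = x} part@(_ , _ , sum≡s) s≤b =
  part , All.map (λ le → ≤-trans le (≤-trans (≤-reflexive sum≡s) s≤b)) (entry≤sum x)

bounded-mono : ∀ {s a b x} → a ≤ b → Bounded s a x → Bounded s b x
bounded-mono a≤b (part , bnd) = part , All.map (λ le → ≤-trans le a≤b) bnd

descending-cons : ∀ {a y} → All (_≤ a) y → Descending y → Descending (a ∷ y)
descending-cons {y = []}    _        _    = [-]
descending-cons {y = _ ∷ _} (le ∷ _) desc = le ∷ desc

bounded-cons : ∀ {s a y} → 1 ≤ a → a ≤ s → Bounded (s ∸ a) a y → Bounded s a (a ∷ y)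
bounded-cons {a = a} 1≤a a≤s ((pos , desc , sum≡) , bnd) =
  (1≤a ∷ pos , descending-cons bnd desc , trans (cong (a +_) sum≡) (m+[n∸m]≡n a≤s)) ,
  ≤-refl ∷ bnd

bounded-tail : ∀ {s a h t} → Bounded s a (h ∷ t) → Bounded (s ∸ h) a t
bounded-tail {h = h} {t} ((_ ∷ pos , desc , sum≡) , _ ∷ bnd) =
  (pos , Linked.tail desc , trans (sym (m+n∸m≡n h (sum t))) (cong (_∸ h) sum≡)) , bnd

-- partitionsWithin f s a lists the partitions of s into parts ≤ a, grouped by
-- whether the largest part equals a; f is fuel, sufficient once s + a < f.
partitionsWithin : ℕ → ℕ → ℕ → List (List ℕ)
partitionsWithinTop : (f s a : ℕ) → Dec (suc a ≤ suc s) → List (List ℕ)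
partitionsWithin zero    s       a       = []
partitionsWithin (suc f) zero    a       = [] ∷ []
partitionsWithin (suc f) (suc s) zero    = []
partitionsWithin (suc f) (suc s) (suc a) = partitionsWithinTop f s a (suc a ≤? suc s)
partitionsWithinTop f s a (yes _) =
  map (suc a ∷_) (partitionsWithin f (suc s ∸ suc a) (suc a)) ++ partitionsWithin f (suc s) a
partitionsWithinTop f s a (no _) = partitionsWithin f (suc s) a

partitionsWithin-sound : ∀ f s a {x} → x ∈ partitionsWithin f s a → Bounded s a x
partitionsWithinTop-sound : ∀ f s a d {x} → x ∈ partitionsWithinTop f s a d → Bounded (suc s) (suc a) x
partitionsWithin-sound (suc f) zero    a       (here refl) = ([] , Linked.[] , refl) , []
partitionsWithin-sound (suc f) (suc s) (suc a) x∈          = partitionsWithinTop-sound f s a (suc a ≤? suc s) x∈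
partitionsWithinTop-sound f s a (yes a≤s) x∈
  with ∈-++⁻ (map (suc a ∷_) (partitionsWithin f (suc s ∸ suc a) (suc a))) x∈
... | inj₂ x∈rest = bounded-mono (n≤1+n a) (partitionsWithin-sound f (suc s) a x∈rest)
... | inj₁ x∈top  with ∈-map⁻ (suc a ∷_) x∈top
...   | y , y∈ , refl = bounded-cons (s≤s z≤n) a≤s (partitionsWithin-sound f _ _ y∈)
partitionsWithinTop-sound f s a (no _) x∈ =
  bounded-mono (n≤1+n a) (partitionsWithin-sound f (suc s) a x∈)

partitionsWithin-complete : ∀ f s a {x} → s + a < f → Bounded s a x → x ∈ partitionsWithin f s a
partitionsWithinTop-complete : ∀ f s a d {x} → suc s + suc a ≤ f → Bounded (suc s) (suc a) x →
  x ∈ partitionsWithinTop f s a d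
partitionsWithin-complete (suc f) zero a {[]} _ _ = here refl
partitionsWithin-complete (suc f) zero a {_ ∷ _} _ ((s≤s _ ∷ _ , _ , ()) , _)
partitionsWithin-complete (suc f) (suc s) zero {[]} _ ((_ , _ , ()) , _)
partitionsWithin-complete (suc f) (suc s) zero {_ ∷ _} _ ((s≤s _ ∷ _ , _) , () ∷ _)
partitionsWithin-complete (suc f) (suc s) (suc a) (s≤s fuel) bnd =
  partitionsWithinTop-complete f s a (suc a ≤? suc s) fuel bnd
partitionsWithinTop-complete f s a d {[]} _ ((_ , _ , ()) , _)
partitionsWithinTop-complete f s a (yes a≤s) {h ∷ t} fuel bnd with h ≟ suc a
... | yes refl = ∈-++⁺ˡ (∈-map⁺ (suc a ∷_) (partitionsWithin-complete f _ _ fuel′ (bounded-tail bnd)))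
  where
  fuel′ : suc s ∸ suc a + suc a < f
  fuel′ rewrite m∸n+n≡m a≤s = <-≤-trans (m<m+n (suc s) (s≤s z≤n)) fuel
... | no h≢a = ∈-++⁺ʳ _ (partitionsWithin-complete f (suc s) a fuel′ (proj₁ bnd , All.map h-bound heads))
  where
  heads = head-bounds (proj₁ (proj₂ (proj₁ bnd)))
  h-bound : ∀ {z} → z ≤ h → z ≤ a
  h-bound z≤h = ≤-trans z≤h (≤-pred (≤∧≢⇒< (All.head (proj₂ bnd)) h≢a))
  fuel′ : suc s + a < f
  fuel′ = <-≤-trans (+-monoʳ-< (suc s) (n<1+n a)) fuel
partitionsWithinTop-complete f s a (no a≰s) {x@(_ ∷ _)} fuel (part , _) =
  partitionsWithin-complete f (suc s) a fuel′ (partition-bounded part (≤-pred (≰⇒> a≰s)))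
  where
  fuel′ : suc s + a < f
  fuel′ = <-≤-trans (+-monoʳ-< (suc s) (n<1+n a)) fuel

partitionsWithin-unique : ∀ f s a → Unique (partitionsWithin f s a)
partitionsWithinTop-unique : ∀ f s a d → Unique (partitionsWithinTop f s a d)
partitionsWithin-unique zero    s       a       = []
partitionsWithin-unique (suc f) zero    a       = [] ∷ []
partitionsWithin-unique (suc f) (suc s) zero    = []
partitionsWithin-unique (suc f) (suc s) (suc a) = partitionsWithinTop-unique f s a (suc a ≤? suc s)
partitionsWithinTop-unique f s a (yes _) =
  Unique.++⁺ (Unique.map⁺ ∷-injectiveʳ (partitionsWithin-unique f _ _))
             (partitionsWithin-unique f _ _) disjoint
  where
  -- the second group has no part equal to suc a
  disjoint : ∀ {v} → ¬ (v ∈ map (suc a ∷_) (partitionsWithin f (suc s ∸ suc a) (suc a))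
                        × v ∈ partitionsWithin f (suc s) a)
  disjoint (v∈top , v∈rest) with ∈-map⁻ (suc a ∷_) v∈top
  ... | _ , _ , refl with partitionsWithin-sound f (suc s) a v∈rest
  ...   | _ , a+1≤a ∷ _ = 1+n≰n a+1≤a
partitionsWithinTop-unique f s a (no _) = partitionsWithin-unique f _ _

partitionsWithin-cong : ∀ {f f′ s s′ a a′} → s + a < f → s′ + a′ < f′ →
  (∀ {x} → Bounded s a x → Bounded s′ a′ x) → (∀ {x} → Bounded s′ a′ x → Bounded s a x) →
  length (partitionsWithin f s a) ≡ length (partitionsWithin f′ s′ a′)
partitionsWithin-cong {f} {f′} {s} {s′} {a} {a′} fuel fuel′ to from =
  sameLength (partitionsWithin-unique f s a) (partitionsWithin-unique f′ s′ a′)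
    (λ x∈ → partitionsWithin-complete f′ s′ a′ fuel′ (to (partitionsWithin-sound f s a x∈)))
    (λ x∈ → partitionsWithin-complete f s a fuel (from (partitionsWithin-sound f′ s′ a′ x∈)))

count : ℕ → ℕ → ℕ
count s a = length (partitionsWithin (suc (s + a)) s a)

count-fuel : ∀ {f} s a → s + a < f → length (partitionsWithin f s a) ≡ count s a
count-fuel s a fuel = partitionsWithin-cong fuel ≤-refl (λ b → b) (λ b → b)

count-bound : ∀ {s} a b → s ≤ a → s ≤ b → count s a ≡ count s b
count-bound a b s≤a s≤b = partitionsWithin-cong ≤-refl ≤-refl
  (λ (part , _) → partition-bounded part s≤b) (λ (part , _) → partition-bounded part s≤a)

-- Classify by whether the largest part is a + 1.
count-rec : ∀ s a → a < s → count s (suc a) ≡ count (s ∸ suc a) (suc a) + count s a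
count-rec (suc s) a (s≤s a≤s) with suc a ≤? suc s
... | no a≰s = ⊥-elim (a≰s (s≤s a≤s))
... | yes a<s = begin
  length (map (suc a ∷_) (partitionsWithin F (suc s ∸ suc a) (suc a)) ++ partitionsWithin F (suc s) a)
    ≡⟨ length-++ (map (suc a ∷_) (partitionsWithin F (suc s ∸ suc a) (suc a))) ⟩
  length (map (suc a ∷_) (partitionsWithin F (suc s ∸ suc a) (suc a))) + length (partitionsWithin F (suc s) a)
    ≡⟨ cong (_+ length (partitionsWithin F (suc s) a))
         (length-map (suc a ∷_) (partitionsWithin F (suc s ∸ suc a) (suc a))) ⟩
  length (partitionsWithin F (suc s ∸ suc a) (suc a)) + length (partitionsWithin F (suc s) a)
    ≡⟨ cong₂ _+_ (count-fuel (suc s ∸ suc a) (suc a) topFuel) (count-fuel (suc s) a restFuel) ⟩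
  count (suc s ∸ suc a) (suc a) + count (suc s) a ∎
  where
  open ≡-Reasoning
  F = suc s + suc a
  topFuel : suc s ∸ suc a + suc a < F
  topFuel rewrite m∸n+n≡m a<s = m<m+n (suc s) (s≤s z≤n)
  restFuel : suc s + a < F
  restFuel = +-monoʳ-< (suc s) (n<1+n a)

count-ones : ∀ s → count s 1 ≡ 1
count-ones zero    = refl
count-ones (suc s) = trans (count-rec (suc s) 0 (s≤s z≤n)) (trans (+-identityʳ _) (count-ones s))

-- withTwo s a counts the partitions of s into parts ≤ a containing a part 2.
-- Deleting one 2 matches them with the partitions of s − 2 into parts ≤ a, so
-- we define it as count (s − 2) a when s, a ≥ 2, and 0 otherwise.
withTwo : ℕ → ℕ → ℕ
withTwo (suc (suc s)) (suc (suc a)) = count s (suc (suc a))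
withTwo _             _             = 0

withTwo-small : ∀ {s} a → s < 2 → withTwo s a ≡ 0
withTwo-small {zero}     a _ = refl
withTwo-small {suc zero} a _ = refl
withTwo-small {suc (suc _)} a (s≤s (s≤s ()))

withTwo-ones : ∀ s → withTwo s 1 ≡ 0
withTwo-ones zero          = refl
withTwo-ones (suc zero)    = refl
withTwo-ones (suc (suc s)) = refl

withTwo-bound : ∀ {s} a b → s ≤ a → s ≤ b → withTwo s a ≡ withTwo s b
withTwo-bound {zero}        a             b             _               _               = refl
withTwo-bound {suc zero}    a             b             _               _               = refl
withTwo-bound {suc (suc s)} (suc (suc a)) (suc (suc b)) (s≤s (s≤s s≤a)) (s≤s (s≤s s≤b)) =
  count-bound (suc (suc a)) (suc (suc b)) (≤-trans s≤a (m≤n+m a 2)) (≤-trans s≤b (m≤n+m b 2))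

-- Every partition into parts ≤ 2 other than all ones contains a 2.
withTwo-two : ∀ s → withTwo s 2 + 1 ≡ count s 2
withTwo-two zero          = refl
withTwo-two (suc zero)    = refl
withTwo-two (suc (suc s)) =
  trans (cong (count s 2 +_) (sym (count-ones (suc (suc s))))) (sym (count-rec (suc (suc s)) 1 (s≤s (s≤s z≤n))))

withTwo-rec : ∀ s a → 2 ≤ a → a < s → withTwo s (suc a) ≡ withTwo (s ∸ suc a) (suc a) + withTwo s a
withTwo-rec _ 0 () _
withTwo-rec _ 1 (s≤s ()) _
withTwo-rec 0 (suc (suc _)) _ ()
withTwo-rec 1 (suc (suc _)) _ (s≤s ())
withTwo-rec (suc (suc s)) a@(suc (suc _)) _ a<s with a <? s
... | yes a<s′ = trans (count-rec s a a<s′) (cong (_+ count s a) (cong (λ t → withTwo t (suc a)) (sym shift)))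
  where
  shift : suc (suc s) ∸ suc a ≡ suc (suc (s ∸ suc a))
  shift = +-∸-assoc 2 a<s′
... | no a≮s = trans (count-bound (suc a) a (m≤n⇒m≤1+n s≤a) s≤a)
                     (sym (cong (_+ count s a) (withTwo-small (suc a) small)))
  where
  s≤a : s ≤ a
  s≤a = ≤-pred (≰⇒> a≮s)
  small : suc (suc s) ∸ suc a < 2
  small = s≤s (≤-trans (∸-monoˡ-≤ (suc a) (s≤s (s≤s s≤a))) (≤-reflexive (m+n∸n≡m 1 a)))

-- c is the number of reads predicted for running through the partitions of s
-- into parts ≤ a: c = 2·count s a − withTwo s a − 2.
ReadCount : ℕ → ℕ → ℕ → Set
ReadCount c s a = c + withTwo s a + 2 ≡ 2 * count s a

-- Nothing to read when a = 1: the single partition into ones is already there.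
readCount-ones : ∀ s → ReadCount 0 s 1
readCount-ones s rewrite withTwo-ones s | count-ones s = refl

readCount-bound : ∀ {c s} a b → s ≤ a → s ≤ b → ReadCount c s a → ReadCount c s b
readCount-bound {c} a b s≤a s≤b reads =
  trans (cong (λ w → c + w + 2) (withTwo-bound b a s≤b s≤a)) (trans reads (cong (2 *_) (count-bound a b s≤a s≤b)))

-- A step popping a part 2 costs one read and completes a block of s + 2.
readCount-pop : ∀ {c} s → ReadCount c s 2 → ReadCount (suc c) (suc (suc s)) 2
readCount-pop {c} s reads = begin
  suc c + count s 2 + 2               ≡⟨ cong (λ n → suc c + n + 2) (sym (withTwo-two s)) ⟩
  suc c + (withTwo s 2 + 1) + 2       ≡⟨ regroup c (withTwo s 2) ⟩
  (c + withTwo s 2 + 2) + 2           ≡⟨ cong (_+ 2) reads ⟩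
  2 * count s 2 + 2                   ≡⟨ double+2 (count s 2) ⟩
  2 * (count s 2 + 1)                 ≡⟨ cong (2 *_) (withTwo-two (suc (suc s))) ⟩
  2 * count (suc (suc s)) 2           ∎
  where
  open ≡-Reasoning
  regroup : ∀ c w → suc c + (w + 1) + 2 ≡ (c + w + 2) + 2
  regroup = solve-∀
  double+2 : ∀ x → 2 * x + 2 ≡ 2 * (x + 1)
  double+2 = solve-∀

-- Decrementing a part a + 1 ≥ 3 costs two reads; the block of s with parts
-- ≤ a + 1 splits into those with largest part a + 1 and those with parts ≤ a.
readCount-decrement : ∀ {c₁ c₂} s a → 2 ≤ a → a < s →
  ReadCount c₁ (s ∸ suc a) (suc a) → ReadCount c₂ s a → ReadCount (c₂ + (2 + c₁)) s (suc a)
readCount-decrement {c₁} {c₂} s a 2≤a a<s reads₁ reads₂ = begin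
  c₂ + (2 + c₁) + withTwo s (suc a) + 2
    ≡⟨ cong (λ w → c₂ + (2 + c₁) + w + 2) (withTwo-rec s a 2≤a a<s) ⟩
  c₂ + (2 + c₁) + (withTwo (s ∸ suc a) (suc a) + withTwo s a) + 2
    ≡⟨ regroup c₁ c₂ (withTwo (s ∸ suc a) (suc a)) (withTwo s a) ⟩
  (c₁ + withTwo (s ∸ suc a) (suc a) + 2) + (c₂ + withTwo s a + 2)
    ≡⟨ cong₂ _+_ reads₁ reads₂ ⟩
  2 * count (s ∸ suc a) (suc a) + 2 * count s a
    ≡⟨ sym (*-distribˡ-+ 2 (count (s ∸ suc a) (suc a)) (count s a)) ⟩
  2 * (count (s ∸ suc a) (suc a) + count s a)
    ≡⟨ cong (2 *_) (sym (count-rec s a a<s)) ⟩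
  2 * count s (suc a) ∎
  where
  open ≡-Reasoning
  regroup : ∀ c₁ c₂ w₁ w₂ → c₂ + (2 + c₁) + (w₁ + w₂) + 2 ≡ (c₁ + w₁ + 2) + (c₂ + w₂ + 2)
  regroup = solve-∀

unique-concatMap : {A B : Set} (g : A → List B) (xs : List A) → Unique xs → (∀ x → Unique (g x)) →
  (∀ {x y z} → z ∈ g x → z ∈ g y → x ≡ y) → Unique (concatMap g xs)
unique-concatMap g []       _          _       _        = []
unique-concatMap g (x ∷ xs) (x∉ ∷ uxs) uniqueG disjoint =
  Unique.++⁺ (uniqueG x) (unique-concatMap g xs uxs uniqueG disjoint) separate
  where
  separate : ∀ {z} → ¬ (z ∈ g x × z ∈ concatMap g xs)
  separate (z∈gx , z∈rest) with find (∈-concatMap⁻ g {xs = xs} z∈rest)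
  ... | y , y∈xs , z∈gy = All.lookup x∉ y∈xs (disjoint z∈gx z∈gy)

-- Lists in listsOf L n have length L, so the blocks of candidates n are disjoint.
listsOf-length : ∀ L n {x} → x ∈ listsOf L n → length x ≡ L
listsOf-length zero    n (here refl) = refl
listsOf-length (suc L) n x∈
  with find (∈-concatMap⁻ (λ y → map (y ∷_) (listsOf L n)) {xs = map suc (upTo n)} x∈)
... | y , _ , x∈y with ∈-map⁻ (y ∷_) x∈y
...   | z , z∈ , refl = cong suc (listsOf-length L n z∈)

-- listsOf L n has no repetitions: distinct heads or, by induction, distinct tails.
listsOf-unique : ∀ L n → Unique (listsOf L n)
listsOf-unique zero    n = [] ∷ []
listsOf-unique (suc L) n =
  unique-concatMap (λ y → map (y ∷_) (listsOf L n)) (map suc (upTo n))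
    (Unique.map⁺ suc-injective (Unique.upTo⁺ n))
    (λ y → Unique.map⁺ ∷-injectiveʳ (listsOf-unique L n)) sameHead
  where
  sameHead : ∀ {x y z} → z ∈ map (x ∷_) (listsOf L n) → z ∈ map (y ∷_) (listsOf L n) → x ≡ y
  sameHead {x} {y} z∈x z∈y with ∈-map⁻ (x ∷_) z∈x | ∈-map⁻ (y ∷_) z∈y
  ... | _ , _ , refl | _ , _ , eq = ∷-injectiveˡ eq

candidates-unique : ∀ n → Unique (candidates n)
candidates-unique n =
  unique-concatMap (λ L → listsOf L n) (upTo (suc n)) (Unique.upTo⁺ (suc n)) (λ L → listsOf-unique L n)
    (λ {L} {L′} z∈L z∈L′ → trans (sym (listsOf-length L n z∈L)) (listsOf-length L′ n z∈L′))

length≤sum : ∀ {x} → All (1 ≤_) x → length x ≤ sum x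
length≤sum []         = z≤n
length≤sum (1≤h ∷ ps) = +-mono-≤ 1≤h (length≤sum ps)

∈listsOf : ∀ n {x} → All (1 ≤_) x → All (_≤ n) x → x ∈ listsOf (length x) n
∈listsOf n []                         []         = here refl
∈listsOf n {suc h ∷ t} (_ ∷ ps) (h<n ∷ bs) =
  ∈-concatMap⁺ (λ y → map (y ∷_) (listsOf (length t) n))
    (lose (∈-map⁺ suc (∈-upTo⁺ h<n)) (∈-map⁺ (suc h ∷_) (∈listsOf n ps bs)))

partition∈candidates : ∀ n {x} → IsPartition n x → x ∈ candidates n
partition∈candidates n {x} part@(pos , _ , sum≡n) =
  ∈-concatMap⁺ (λ L → listsOf L n)
    (lose (∈-upTo⁺ (s≤s (≤-trans (length≤sum pos) (≤-reflexive sum≡n))))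
          (∈listsOf n pos (proj₂ (partition-bounded part ≤-refl))))

p≡count : ∀ n → p n ≡ count n n
p≡count n =
  sameLength (Unique.filter⁺ (isPartition? n) (candidates-unique n)) (partitionsWithin-unique (suc (n + n)) n n)
  (λ x∈ → partitionsWithin-complete (suc (n + n)) n n ≤-refl
            (partition-bounded (proj₂ (∈-filter⁻ (isPartition? n) {xs = candidates n} x∈)) ≤-refl))
  (λ x∈ → let part = proj₁ (partitionsWithin-sound (suc (n + n)) n n x∈)
          in ∈-filter⁺ (isPartition? n) (partition∈candidates n part) part)

upd-same : ∀ d i v → upd d i v i ≡ v
upd-same d i v rewrite dec-true (i ≟ i) refl = refl

upd-other : ∀ d i v {j} → j ≢ i → upd d i v j ≡ d j
upd-other d i v {j} j≢i rewrite dec-false (j ≟ i) j≢i = refl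

-- Stack d stk: cells |stk|, …, 2, 1 of d hold the entries of stk, top first.
Stack : (ℕ → ℕ) → List ℕ → Set
Stack d []       = ⊤
Stack d (x ∷ xs) = d (suc (length xs)) ≡ x × Stack d xs

stack-upd : ∀ {d stk i v} → Stack d stk → length stk < i → Stack (upd d i v) stk
stack-upd {stk = []}             _               _     = tt
stack-upd {d} {x ∷ xs} {i} {v} (top , rest) |stk|<i =
  trans (upd-other d i v (λ eq → <-irrefl eq |stk|<i)) top , stack-upd rest (<-trans (n<1+n _) |stk|<i)

-- At the head of the outer loop: d_1 … d_q are the stack stk of parts > 1,
-- followed by r parts equal to one (k = q + r), after c reads.
AtOuter : List ℕ → ℕ → ℕ → State → Set
AtOuter stk r c st =
  pc st ≡ outer × q st ≡ length stk × k st ≡ length stk + r × reads st ≡ c × Stack (d st) stk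

AtInner : List ℕ → ℕ → ℕ → ℕ → State → Set
AtInner stk μ t c st =
  pc st ≡ inner × q st ≡ length stk × m st ≡ μ × n' st ≡ t × reads st ≡ c × Stack (d st) stk

data _↠_ : State → State → Set where
  done : ∀ {st} → st ↠ st
  more : ∀ {st st′ st″} → step st ≡ next st′ → st′ ↠ st″ → st ↠ st″

↠-trans : ∀ {st₁ st₂ st₃} → st₁ ↠ st₂ → st₂ ↠ st₃ → st₁ ↠ st₃
↠-trans done           trace = trace
↠-trans (more eq rest) trace = more eq (↠-trans rest trace)

steps : ∀ {st st′} → st ↠ st′ → ℕ
steps done          = 0
steps (more _ rest) = suc (steps rest)

run-reaches : ∀ {st st′ c} (trace : st ↠ st′) → step st′ ≡ halt c → run (suc (steps trace)) st ≡ just c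
run-reaches done          halts rewrite halts = refl
run-reaches (more eq rest) halts rewrite eq   = run-reaches rest halts

-- Fill s a stk stk′ r: greedily filling s with parts ≤ a (i.e. writing the
-- lexicographically largest partition of s into parts ≤ a) on top of stk
-- yields the stack stk′ and r trailing ones; ones are never stacked.
data Fill : ℕ → ℕ → List ℕ → List ℕ → ℕ → Set where
  fill-ones   : ∀ {s stk} → Fill s 1 stk stk s
  fill-zero   : ∀ {a stk} → Fill 0 a stk stk 0
  fill-push   : ∀ {s a stk stk′ r} → 2 ≤ a → a ≤ s → Fill (s ∸ a) a (a ∷ stk) stk′ r → Fill s a stk stk′ r
  fill-shrink : ∀ {s a stk stk′ r} → 1 ≤ s → s < a → Fill s s stk stk′ r → Fill s a stk stk′ r

step-push : ∀ d k q μ t c → μ ≤ t →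
  step (mkState d k (suc q) μ t c inner) ≡ next (mkState (upd d (suc (suc q)) μ) k (suc (suc q)) μ (t ∸ μ) c inner)
step-push d k q μ t c μ≤t rewrite dec-true (μ ≤? t) μ≤t = refl

step-exit-zero : ∀ d k q μ c →
  step (mkState d k (suc q) (suc μ) 0 c inner) ≡ next (mkState d (suc q) (suc q) (suc μ) 0 c outer)
step-exit-zero d k q μ c = refl

step-exit-one : ∀ d k q μ c →
  step (mkState d k (suc q) (suc (suc μ)) 1 c inner) ≡ next (mkState d (suc (suc q)) (suc q) (suc (suc μ)) 1 c outer)
step-exit-one d k q μ c = refl

step-exit-part : ∀ d k q μ t c → suc (suc t) < μ →
  step (mkState d k (suc q) μ (suc (suc t)) c inner)
    ≡ next (mkState (upd d (suc (suc q)) (suc (suc t))) (suc (suc q)) (suc (suc q)) μ (suc (suc t)) c outer)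
step-exit-part d k q μ t c t<μ rewrite dec-false (μ ≤? suc (suc t)) (<⇒≱ t<μ) = refl

step-pop : ∀ d k q μ n c → d (suc q) ≡ 2 →
  step (mkState d k (suc q) μ n c outer) ≡ next (mkState (upd d (suc q) 1) (suc k) q μ n (suc c) outer)
step-pop d k q μ n c top rewrite top = refl

step-decrement : ∀ d k q μ n c b → d (suc q) ≡ suc (suc (suc b)) →
  step (mkState d k (suc q) μ n c outer)
    ≡ next (mkState (upd d (suc q) (suc (suc b))) k (suc q) (suc (suc b)) (suc k ∸ suc q) (suc (suc c)) inner)
step-decrement d k q μ n c b top rewrite top = refl

fill-done : ∀ {a stk} → Fill (a ∸ a) a stk stk 0
fill-done {a} {stk} = subst (λ s → Fill s a stk stk 0) (sym (n∸n≡0 a)) fill-zero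

Refills : ℕ → ℕ → List ℕ → ℕ → State → Set
Refills t μ stk c st =
  Σ State λ st′ → st ↠ st′ × Σ (List ℕ) λ stk′ → Σ ℕ λ r → Fill t μ stk stk′ r × AtOuter stk′ r c st′

innerExit : ∀ t {x stk μ c} st → 2 ≤ μ → t < μ → AtInner (x ∷ stk) μ t c st →
  Refills t μ (x ∷ stk) c st
innerExit zero {x} {stk} {suc μ} {c} (mkState d k _ _ _ _ _) _ _ (refl , refl , refl , refl , refl , stack) =
  mkState d (suc (length stk)) (suc (length stk)) (suc μ) 0 c outer ,
  more (step-exit-zero d k (length stk) μ c) done ,
  x ∷ stk , 0 , fill-zero , (refl , refl , sym (+-identityʳ _) , refl , stack)
innerExit (suc zero) {x} {stk} {suc (suc μ)} {c} (mkState d k _ _ _ _ _) _ _ (refl , refl , refl , refl , refl , stack) =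
  mkState d (suc (suc (length stk))) (suc (length stk)) (suc (suc μ)) 1 c outer ,
  more (step-exit-one d k (length stk) μ c) done ,
  x ∷ stk , 1 , fill-shrink (s≤s z≤n) (s≤s (s≤s z≤n)) fill-ones ,
  (refl , refl , sym (+-comm (suc (length stk)) 1) , refl , stack)
innerExit (suc zero) {μ = suc zero} _ (s≤s ()) _ _
innerExit (suc (suc t)) {x} {stk} {μ} {c} (mkState d k _ _ _ _ _) _ t<μ (refl , refl , refl , refl , refl , stack) =
  mkState (upd d (suc (suc (length stk))) (suc (suc t)))
          (suc (suc (length stk))) (suc (suc (length stk))) μ (suc (suc t)) c outer ,
  more (step-exit-part d k (length stk) μ t c t<μ) done ,
  suc (suc t) ∷ x ∷ stk , 0 , fill-shrink (s≤s z≤n) t<μ (fill-push (s≤s (s≤s z≤n)) ≤-refl fill-done) ,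
  (refl , refl , sym (+-identityʳ _) , refl , upd-same d _ _ , stack-upd stack (n<1+n _))

innerLoop : ∀ t → Acc _<_ t → ∀ {x stk μ c} st → 2 ≤ μ → AtInner (x ∷ stk) μ t c st →
  Refills t μ (x ∷ stk) c st
innerLoop t (acc rec) {x} {stk} {μ} {c} st@(mkState d k _ _ _ _ _) 2≤μ at@(refl , refl , refl , refl , refl , stack)
  with μ ≤? t
... | no μ≰t = innerExit t st 2≤μ (≰⇒> μ≰t) at
... | yes μ≤t
  with innerLoop (t ∸ μ) (rec (∸-monoʳ-< (≤-trans (s≤s z≤n) 2≤μ) μ≤t))
         (mkState (upd d (suc (suc (length stk))) μ) k (suc (suc (length stk))) μ (t ∸ μ) c inner) 2≤μ
         (refl , refl , refl , refl , refl , upd-same d _ _ , stack-upd stack ≤-refl)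
...   | st′ , trace , stk′ , r , fill , at′ =
  st′ , more (step-push d k (length stk) μ t c μ≤t) trace , stk′ , r , fill-push 2≤μ μ≤t fill , at′

popStep : ∀ {stk r c} st → AtOuter (2 ∷ stk) r c st →
  Σ State λ st′ → step st ≡ next st′ × AtOuter stk (suc (suc r)) (suc c) st′
popStep {stk} {r} {c} (mkState d _ _ μ n _ _) (refl , refl , refl , refl , top , stack) =
  mkState (upd d (suc (length stk)) 1) (suc (suc (length stk) + r)) (length stk) μ n (suc c) outer ,
  step-pop d _ (length stk) μ n c top ,
  (refl , refl , sym (trans (+-suc (length stk) (suc r)) (cong suc (+-suc (length stk) r))) , refl ,
   stack-upd stack (n<1+n _))

-- d_q = b + 3 above r ones: for two reads it becomes b + 2, and the inner
-- loop refills the remaining r + 1 greedily with parts ≤ b + 2.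
decrementStep : ∀ {stk r c b} st → AtOuter (suc (suc (suc b)) ∷ stk) r c st →
  Refills (suc (suc b) + suc r) (suc (suc b)) stk (suc (suc c)) st
decrementStep {stk} {r} {c} {b} (mkState d _ _ μ n _ _) (refl , refl , refl , refl , top , stack)
  with innerLoop (suc r) (<-wellFounded (suc r))
         (mkState (upd d (suc (length stk)) (suc (suc b))) (suc (length stk) + r) (suc (length stk))
                  (suc (suc b)) (suc (suc (length stk) + r) ∸ suc (length stk)) (suc (suc c)) inner)
         (s≤s (s≤s z≤n))
         (refl , refl , refl , refill , refl , upd-same d (suc (length stk)) (suc (suc b)) , stack-upd stack (n<1+n _))
  where
  refill : suc (suc (length stk) + r) ∸ suc (length stk) ≡ suc r
  refill = trans (cong (_∸ suc (length stk)) (sym (+-suc (suc (length stk)) r))) (m+n∸m≡n (suc (length stk)) (suc r))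
... | st′ , trace , stk′ , r′ , fill , at′ =
  st′ , more (step-decrement d (suc (length stk) + r) (length stk) μ n c b top) trace , stk′ , r′ ,
  fill-push (s≤s (s≤s z≤n)) (m≤m+n (suc (suc b)) (suc r))
    (subst (λ t → Fill t (suc (suc b)) (suc (suc b) ∷ stk) stk′ r′) (sym (m+n∸m≡n (suc (suc b)) (suc r))) fill) ,
  at′

simulate : ∀ s a → Acc _<_ (s + a) → ∀ {stk stk′ r c} st → Fill s a stk stk′ r → AtOuter stk′ r c st →
  Σ State λ st′ → st ↠ st′ × Σ ℕ λ c′ → AtOuter stk s (c′ + c) st′ × ReadCount c′ s a
simulate s 1 _ st fill-ones at = st , done , 0 , at , readCount-ones s
simulate 0 a _ st fill-zero at = st , done , 0 , at , refl
simulate s a (acc rec) st (fill-shrink _ s<a fill) at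
  with simulate s s (rec (+-monoʳ-< s s<a)) st fill at
... | st′ , trace , c′ , at′ , reads = st′ , trace , c′ , at′ , readCount-bound s a ≤-refl (<⇒≤ s<a) reads
simulate s 0 _ _ (fill-push () _ _) _
simulate s 1 _ _ (fill-push (s≤s ()) _ _) _
simulate (suc zero) 2 _ _ (fill-push _ (s≤s ()) _) _
-- a = 2: run through the block of s − 2 above the 2, then pop it.
simulate (suc (suc s)) 2 (acc rec) st (fill-push _ _ fill) at
  with simulate s 2 (rec (+-monoˡ-< 2 (<-trans (n<1+n s) (n<1+n (suc s))))) st fill at
... | st₁ , trace₁ , c₁ , at₁ , reads₁ with popStep st₁ at₁
...   | st₂ , popped , at₂ = st₂ , ↠-trans trace₁ (more popped done) , suc c₁ , at₂ , readCount-pop s reads₁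
-- a ≥ 3: run through the block of s − a above the part a, decrement it to
-- a − 1 (which refills greedily), and run through the block of s bounded by a − 1.
simulate s a@(suc (suc (suc b))) (acc rec) {stk} {c = c} st (fill-push _ a≤s fill) at
  with simulate (s ∸ a) a (rec (subst (_< s + a) (sym (m∸n+n≡m a≤s)) (m<m+n s (s≤s z≤n)))) st fill at
... | st₁ , trace₁ , c₁ , at₁ , reads₁ with decrementStep st₁ at₁
...   | st₂ , trace₂ , stk₂ , r₂ , fill₂ , at₂
  with simulate s (suc (suc b)) (rec (+-monoʳ-< s ≤-refl)) st₂
         (subst (λ t → Fill t (suc (suc b)) stk stk₂ r₂)
                (trans (+-suc (suc (suc b)) (s ∸ a)) (m+[n∸m]≡n a≤s)) fill₂)
         at₂
...   | st₃ , trace₃ , c₂ , at₃ , reads₂ =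
  st₃ , ↠-trans trace₁ (↠-trans trace₂ trace₃) , c₂ + (2 + c₁) ,
  subst (λ c′ → AtOuter stk s c′ st₃) (sym (+-assoc c₂ (2 + c₁) c)) at₃ ,
  readCount-decrement s (suc (suc b)) (s≤s (s≤s z≤n)) a≤s reads₁ reads₂

initialFill : ∀ {n} → 2 ≤ n → Fill n n [] (n ∷ []) 0
initialFill 2≤n = fill-push 2≤n ≤-refl fill-done

initialState : ∀ n → 2 ≤ n → AtOuter (n ∷ []) 0 0 (initState n)
initialState (suc (suc n)) _ = refl , refl , refl , refl , refl , tt
initialState (suc zero) (s≤s ())

halts : ∀ {r c} st → AtOuter [] r c st → step st ≡ halt c
halts (mkState _ _ _ _ _ _ _) (refl , refl , _ , refl , _) = refl

withTwo-diagonal : ∀ n → 2 ≤ n → withTwo n n ≡ p (n ∸ 2)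
withTwo-diagonal (suc zero) (s≤s ())
withTwo-diagonal (suc (suc n)) _ = trans (count-bound (suc (suc n)) n (m≤n+m n 2) ≤-refl) (sym (p≡count n))

theorem4p15 : (n : ℕ) → 2 ≤ n →
    Σ ℕ λ fuel → Σ ℕ λ c →
      run fuel (initState n) ≡ just c × c + p (n ∸ 2) + 2 ≡ 2 * p n
theorem4p15 n 2≤n
  with simulate n n (<-wellFounded (n + n)) (initState n) (initialFill 2≤n) (initialState n 2≤n)
... | st , trace , c , final , reads =
  suc (steps trace) , c + 0 , run-reaches trace (halts st final) , (begin
    c + 0 + p (n ∸ 2) + 2     ≡⟨ cong (λ x → x + p (n ∸ 2) + 2) (+-identityʳ c) ⟩
    c + p (n ∸ 2) + 2         ≡⟨ cong (λ w → c + w + 2) (sym (withTwo-diagonal n 2≤n)) ⟩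
    c + withTwo n n + 2       ≡⟨ reads ⟩
    2 * count n n             ≡⟨ cong (2 *_) (sym (p≡count n)) ⟩
    2 * p n                   ∎)
  where open ≡-Reasoning
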